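{- For integers $n\ge 1$ let $f(n)=\#\{k : 1\le k\le n,\ k\equiv n \pmod{2^k}\}$. Then $f(1)=1$ and, for all integers $i\ge 0$ and $1\le j\le 2^i$, $$ f(2^i+j)=\begin{cases} f(j)+1 & \text{if } 1\le j\le i,\\ f(j) & \text{if } i+1\le j\le 2^i.\end{cases} $$ -}

module Defs where

open import Data.Nat using (ℕ; zero; suc; _^_; _%_; _≟_)
open import Data.Nat.Properties using (m^n≢0)
open import Data.List using (List; length; filter; upTo; map)
open import Relation.Binary.PropositionalEquality using (_≡_)

oneTo : ℕ → List ℕ
oneTo n = map suc (upTo n)

f : ℕ → ℕ
f n = length (filter (λ k → let instance _ = m^n≢0 2 k in k % (2 ^ k) ≟ n % (2 ^ k)) (oneTo n))

{-# OPTIONS --safe #-}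
-- Call k a hit for n when k ≡ n (mod 2^k), so f(n) counts the hits for n in [1, n]. As
-- k < 2^k, a hit k ≥ 1 for some n ≤ 2^k must equal n (n mod 2^k is n, or 0 if n = 2^k).
-- So if i < n ≤ 2^(i+1), the hits for n are those in [1, i] together with n itself. For
-- n = 2^i + j with j ≤ 2^i, the hits for n in [1, i] are those for j, because 2^k ∣ 2^i;
-- hence f(2^i + j) = 1 + #{hits for j in [1, i]}. If i < j, the same window argument gives
-- f(j) = 1 + #{hits for j in [1, i]}; if j ≤ i, j has no hits k > j, so that count is f(j).
module Submission where

open import Defs
open import Data.Nat using (ℕ; zero; suc; _+_; _*_; _∸_; _^_; _≤_; _<_; _%_; _≟_; z≤n; s≤s; s≤s⁻¹)
open import Data.Nat.Properties
open import Data.Nat.DivMod using (m<n⇒m%n≡m; n%n≡0; %-remove-+ˡ)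
open import Data.Nat.Divisibility using (_∣_; divides)
open import Data.List using ([]; [_]; length; filter; upTo; map; _++_)
open import Data.List.Properties using (upTo-∷ʳ; map-++; length-++; filter-++; filter-accept; filter-reject)
open import Data.Product using (_×_; _,_)
open import Data.Sum using (inj₁; inj₂)
open import Function using (_∘_)
open import Relation.Nullary using (¬_; Dec; yes; no)
open import Relation.Binary.PropositionalEquality using (_≡_; _≢_; refl; sym; trans; cong; module ≡-Reasoning)
open ≡-Reasoning

-- Instance search cannot produce NonZero (2 ^ k) for a variable k, so it is supplied here.
infixl 7 _%2^_
_%2^_ : ℕ → ℕ → ℕ
n %2^ k = _%_ n (2 ^ k) {{m^n≢0 2 k}}

2^[1+n]≡2^n+2^n : ∀ n → 2 ^ suc n ≡ 2 ^ n + 2 ^ n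
2^[1+n]≡2^n+2^n n = cong (2 ^ n +_) (+-identityʳ (2 ^ n))

n<2^n : ∀ n → n < 2 ^ n
n<2^n zero    = s≤s z≤n
n<2^n (suc n) = ≤-trans (+-mono-≤ (m^n>0 2 n) (n<2^n n)) (≤-reflexive (sym (2^[1+n]≡2^n+2^n n)))

m^n∣m^o : ∀ m {n o} → n ≤ o → m ^ n ∣ m ^ o
m^n∣m^o m {n} {o} n≤o = divides (m ^ (o ∸ n)) (begin
  m ^ o                 ≡⟨ cong (m ^_) (sym (m∸n+n≡m n≤o)) ⟩
  m ^ (o ∸ n + n)       ≡⟨ ^-distribˡ-+-* m (o ∸ n) n ⟩
  m ^ (o ∸ n) * m ^ n   ∎)

[2^i+j]%2^k≡j%2^k : ∀ {i k} j → k ≤ i → (2 ^ i + j) %2^ k ≡ j %2^ k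
[2^i+j]%2^k≡j%2^k {k = k} j k≤i = %-remove-+ˡ j {{m^n≢0 2 k}} (m^n∣m^o 2 k≤i)

m<2^n⇒m%2^n≡m : ∀ {m} n → m < 2 ^ n → m %2^ n ≡ m
m<2^n⇒m%2^n≡m n = m<n⇒m%n≡m {{m^n≢0 2 n}}

2^n%2^n≡0 : ∀ n → 2 ^ n %2^ n ≡ 0
2^n%2^n≡0 n = n%n≡0 (2 ^ n) {{m^n≢0 2 n}}

Hit : ℕ → ℕ → Set
Hit n k = k %2^ k ≡ n %2^ k

hit? : ∀ n k → Dec (Hit n k)
hit? n k = k %2^ k ≟ n %2^ k

hits : ℕ → ℕ → ℕ
hits n m = length (filter (hit? n) (oneTo m))

¬Hit : ∀ {n k} → 1 ≤ k → n ≤ 2 ^ k → n ≢ k → ¬ Hit n k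
¬Hit {n} {k} 1≤k n≤2^k n≢k k%≡n% with m≤n⇒m<n∨m≡n n≤2^k
... | inj₁ n<2^k = n≢k (begin
  n        ≡⟨ m<2^n⇒m%2^n≡m k n<2^k ⟨
  n %2^ k  ≡⟨ k%≡n% ⟨
  k %2^ k  ≡⟨ m<2^n⇒m%2^n≡m k (n<2^n k) ⟩
  k        ∎)
... | inj₂ refl = <⇒≢ 1≤k (begin
  0            ≡⟨ 2^n%2^n≡0 k ⟨
  2 ^ k %2^ k  ≡⟨ k%≡n% ⟨
  k %2^ k      ≡⟨ m<2^n⇒m%2^n≡m k (n<2^n k) ⟩
  k            ∎)

oneTo-suc : ∀ m → oneTo (suc m) ≡ oneTo m ++ [ suc m ]
oneTo-suc m = trans (cong (map suc) (sym (upTo-∷ʳ m))) (map-++ suc (upTo m) [ m ])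

hits-suc : ∀ n m → hits n (suc m) ≡ hits n m + length (filter (hit? n) [ suc m ])
hits-suc n m = begin
  length (filter (hit? n) (oneTo (suc m)))
    ≡⟨ cong (length ∘ filter (hit? n)) (oneTo-suc m) ⟩
  length (filter (hit? n) (oneTo m ++ [ suc m ]))
    ≡⟨ cong length (filter-++ (hit? n) (oneTo m) [ suc m ]) ⟩
  length (filter (hit? n) (oneTo m) ++ filter (hit? n) [ suc m ])
    ≡⟨ length-++ (filter (hit? n) (oneTo m)) ⟩
  hits n m + length (filter (hit? n) [ suc m ])
    ∎

hits-hit : ∀ n m → Hit n (suc m) → hits n (suc m) ≡ suc (hits n m)
hits-hit n m hit = begin
  hits n (suc m)                                 ≡⟨ hits-suc n m ⟩
  hits n m + length (filter (hit? n) [ suc m ])  ≡⟨ cong (λ xs → hits n m + length xs) (filter-accept (hit? n) {x = suc m} {xs = []} hit) ⟩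
  hits n m + 1                                   ≡⟨ +-comm (hits n m) 1 ⟩
  suc (hits n m)                                 ∎

hits-miss : ∀ n m → ¬ Hit n (suc m) → hits n (suc m) ≡ hits n m
hits-miss n m miss = begin
  hits n (suc m)                                 ≡⟨ hits-suc n m ⟩
  hits n m + length (filter (hit? n) [ suc m ])  ≡⟨ cong (λ xs → hits n m + length xs) (filter-reject (hit? n) {x = suc m} {xs = []} miss) ⟩
  hits n m + 0                                   ≡⟨ +-identityʳ (hits n m) ⟩
  hits n m                                       ∎

hits-cong : ∀ {n n′} m → (∀ {k} → k ≤ m → n %2^ k ≡ n′ %2^ k) → hits n m ≡ hits n′ m
hits-cong zero _ = refl
hits-cong {n} {n′} (suc m) n≡n′ with hit? n (suc m)
... | yes hit = begin
  hits n (suc m)    ≡⟨ hits-hit n m hit ⟩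
  suc (hits n m)    ≡⟨ cong suc (hits-cong m (λ k≤m → n≡n′ (m≤n⇒m≤1+n k≤m))) ⟩
  suc (hits n′ m)   ≡⟨ hits-hit n′ m (trans hit (n≡n′ ≤-refl)) ⟨
  hits n′ (suc m)   ∎
... | no miss = begin
  hits n (suc m)    ≡⟨ hits-miss n m miss ⟩
  hits n m          ≡⟨ hits-cong m (λ k≤m → n≡n′ (m≤n⇒m≤1+n k≤m)) ⟩
  hits n′ m         ≡⟨ hits-miss n′ m (λ hit′ → miss (trans hit′ (sym (n≡n′ ≤-refl)))) ⟨
  hits n′ (suc m)   ∎

hits-skip : ∀ {n a b} → a ≤ b → (∀ {k} → a < k → k ≤ b → ¬ Hit n k) → hits n b ≡ hits n a
hits-skip {b = zero} z≤n _ = refl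
hits-skip {n} {b = suc b} a≤1+b gap with m≤n⇒m<n∨m≡n a≤1+b
... | inj₂ refl = refl
... | inj₁ a<1+b = trans (hits-miss n b (gap a<1+b ≤-refl))
                         (hits-skip (s≤s⁻¹ a<1+b) (λ a<k k≤b → gap a<k (m≤n⇒m≤1+n k≤b)))

hits-stable : ∀ {j a b} → j ≤ a → a ≤ b → hits j b ≡ hits j a
hits-stable j≤a a≤b = hits-skip a≤b λ a<k _ →
  let j<k = ≤-<-trans j≤a a<k
  in ¬Hit (≤-trans (s≤s z≤n) a<k) (<⇒≤ (<-trans j<k (n<2^n _))) (<⇒≢ j<k)

f≡1+hits : ∀ {n i} → i < n → n ≤ 2 ^ suc i → f n ≡ suc (hits n i)
f≡1+hits {suc m} {i} (s≤s i≤m) n≤2^[1+i] = begin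
  f (suc m)              ≡⟨ hits-hit (suc m) m refl ⟩
  suc (hits (suc m) m)   ≡⟨ cong suc (hits-skip i≤m gap) ⟩
  suc (hits (suc m) i)   ∎
  where
  gap : ∀ {k} → i < k → k ≤ m → ¬ Hit (suc m) k
  gap i<k k≤m = ¬Hit (≤-trans (s≤s z≤n) i<k) (≤-trans n≤2^[1+i] (^-monoʳ-≤ 2 i<k)) (>⇒≢ (s≤s k≤m))

f[2^i+j]≡1+hits[j,i] : ∀ i {j} → j ≤ 2 ^ i → f (2 ^ i + j) ≡ suc (hits j i)
f[2^i+j]≡1+hits[j,i] i {j} j≤2^i = begin
  f (2 ^ i + j)             ≡⟨ f≡1+hits i<2^i+j 2^i+j≤2^[1+i] ⟩
  suc (hits (2 ^ i + j) i)  ≡⟨ cong suc (hits-cong i (λ k≤i → [2^i+j]%2^k≡j%2^k j k≤i)) ⟩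
  suc (hits j i)            ∎
  where
  i<2^i+j : i < 2 ^ i + j
  i<2^i+j = ≤-trans (n<2^n i) (m≤m+n (2 ^ i) j)
  2^i+j≤2^[1+i] : 2 ^ i + j ≤ 2 ^ suc i
  2^i+j≤2^[1+i] = ≤-trans (+-monoʳ-≤ (2 ^ i) j≤2^i) (≤-reflexive (sym (2^[1+n]≡2^n+2^n i)))

-- The argument also covers j = 0.
theorem6 : f 1 ≡ 1 ×
    ((i j : ℕ) → 1 ≤ j → j ≤ 2 ^ i →
      (j ≤ i → f (2 ^ i + j) ≡ suc (f j)) ×
      (suc i ≤ j → f (2 ^ i + j) ≡ f j))
theorem6 = refl , λ i j _ j≤2^i →
    (λ j≤i → begin
      f (2 ^ i + j)   ≡⟨ f[2^i+j]≡1+hits[j,i] i j≤2^i ⟩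
      suc (hits j i)  ≡⟨ cong suc (hits-stable ≤-refl j≤i) ⟩
      suc (f j)       ∎)
  , (λ i<j → begin
      f (2 ^ i + j)   ≡⟨ f[2^i+j]≡1+hits[j,i] i j≤2^i ⟩
      suc (hits j i)  ≡⟨ f≡1+hits i<j (≤-trans j≤2^i (^-monoʳ-≤ 2 (n≤1+n i))) ⟨
      f j             ∎)
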